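{- For any PNOI instance there is an optimal policy $\mathcal{A}$ described by a subset $T^*$ of the boxes, an ordering $\sigma$ of $T^*$, and a threshold $V_i$ for each box $i\in T^*$ except the last one in the order $\sigma$, such that: if $T^*=\emptyset$, $\mathcal{A}$ is the index-based policy; otherwise $\mathcal{A}$ opens the boxes of $T^*$ in the order $\sigma$ until either it sees a value $v_i\ge V_i$ from some box $i$, or only one box of $T^*$ remains unopened. Once it sees a value $v_i\ge V_i$ from a box $i\in T^*$, $\mathcal{A}$ switches to running the index-based policy on the remaining (unopened) boxes, taking the highest value seen so far as a free outside option; if this does not happen before only one box of $T^*$ remains unopened, $\mathcal{A}$ takes that last box without inspection.
   Context: An instance of Pandora's problem with non-obligatory inspection (PNOI) consists of $n$ boxes; box $i$ has a search cost $c_i\ge0$ and contains a hidden value $v_i\ge0$ drawn independently from a known (finitely supported) distribution $F_i$. A policy proceeds in steps: at each step it may open an unopened box $i$, paying $c_i$ and observing $v_i$; or stop and take the opened box with the highest revealed value; or stop and take an unopened box $i$ without inspecting it, receiving $v_i$. The payoff is the value taken minus the total cost of opened boxes; an optimal policy maximizes expected payoff. The index $\tau_i$ of box $i$ is the unique solution of $\mathbb{E}[(v_i-\tau_i)_+]=c_i$. The index-based policy on a set of unopened boxes with a free outside option of value $w$ (w $=0$ if there is none) repeatedly does the following: if the largest index among unopened boxes exceeds both $w$ and every value revealed so far, it opens that box; otherwise it stops and takes the largest among $w$ and the revealed values. It never takes an unopened box.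
   Formalization: The costs, the values and the probabilities of the distributions $F_i$ are rational, and the thresholds $V_i$ are taken in ℚ. -}

module Defs where

open import Data.Nat using (ℕ)
open import Data.Fin using (Fin; _≟_)
open import Data.Rational using (ℚ; 0ℚ; 1ℚ; _+_; _*_; _-_; _⊔_; _≤_; _<_; -_)
open import Data.List using (List; []; _∷_; foldr; map; allFin)
open import Data.List.Relation.Unary.All using (All)
open import Data.Maybe using (Maybe; just; nothing)
open import Data.Product using (Σ; _×_; _,_; proj₁; proj₂)
open import Data.Empty using (⊥)
open import Data.Unit using (⊤)
open import Relation.Nullary using (yes; no)
open import Relation.Binary.PropositionalEquality using (_≡_)

record Dist : Set where
  field
    support   : List (ℚ × ℚ)
    values≥0  : All (λ vp → 0ℚ ≤ proj₁ vp) support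
    probs≥0   : All (λ vp → 0ℚ ≤ proj₂ vp) support
    probsSum1 : foldr (λ vp acc → proj₂ vp + acc) 0ℚ support ≡ 1ℚ
open Dist public

𝔼 : Dist → (ℚ → ℚ) → ℚ
𝔼 F g = foldr (λ vp acc → proj₂ vp * g (proj₁ vp) + acc) 0ℚ (support F)

IsIndex : Dist → ℚ → ℚ → Set
IsIndex F c τ = 𝔼 F (λ v → (v - τ) ⊔ 0ℚ) ≡ c

data Policy (n : ℕ) : Set where
  -- stop and take the opened box with the highest revealed value (0 if none)
  stop     : Policy n
  -- stop and take the unopened box i without inspecting it
  takeBox  : Fin n → Policy n
  openBox  : Fin n → (ℚ → Policy n) → Policy n

-- Information state: which boxes are opened and their revealed values.
State : ℕ → Set
State n = Fin n → Maybe ℚ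

initial : ∀ {n} → State n
initial _ = nothing

update : ∀ {n} → State n → Fin n → ℚ → State n
update s i v j with j ≟ i
... | yes _ = just v
... | no  _ = s j

maxList : List ℚ → ℚ
maxList = foldr _⊔_ 0ℚ

revealed : ∀ {n} → State n → List ℚ
revealed {n} s = go (allFin n)
  where
  go : List (Fin n) → List ℚ
  go [] = []
  go (j ∷ js) with s j
  ... | just v  = v ∷ go js
  ... | nothing = go js

-- highest revealed value (0 if nothing revealed; all values are ≥ 0)
best : ∀ {n} → State n → ℚ
best s = maxList (revealed s)

Valid : ∀ {n} → State n → Policy n → Set
Valid s stop          = ⊤
Valid s (takeBox i)   = s i ≡ nothing
Valid s (openBox i k) = (s i ≡ nothing) × (∀ v → Valid (update s i v) (k v))

-- Expected payoff (value taken minus costs paid from now on), from a state.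
payoff : ∀ {n} → (Fin n → ℚ) → (Fin n → Dist) → State n → Policy n → ℚ
payoff c F s stop          = best s
payoff c F s (takeBox i)   = 𝔼 (F i) (λ v → v)
payoff c F s (openBox i k) = 𝔼 (F i) (λ v → payoff c F (update s i v) (k v)) - c i

Optimal : ∀ {n} → (Fin n → ℚ) → (Fin n → Dist) → Policy n → Set
Optimal {n} c F A =
  Valid initial A × (∀ (P : Policy n) → Valid initial P → payoff c F initial P ≤ payoff c F initial A)

IsIndexPolicy : ∀ {n} → (Fin n → ℚ) → ℚ → State n → Policy n → Set
IsIndexPolicy τ w s stop =
  ∀ j → s j ≡ nothing → τ j ≤ w ⊔ best s
IsIndexPolicy τ w s (takeBox i) = ⊥
IsIndexPolicy τ w s (openBox i k) =
  (s i ≡ nothing) × (∀ j → s j ≡ nothing → τ j ≤ τ i) × (w ⊔ best s < τ i)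
  × (∀ v → IsIndexPolicy τ w (update s i v) (k v))

ThresholdPhase : ∀ {n} → (Fin n → ℚ) → List (Fin n) → (Fin n → ℚ) → State n → Policy n → Set
ThresholdPhase τ [] V s A = ⊥
ThresholdPhase τ (i ∷ []) V s A = A ≡ takeBox i
ThresholdPhase τ (i ∷ j ∷ σ) V s A =
  Σ (ℚ → Policy _) λ k → (A ≡ openBox i k) ×
    (∀ v → (V i ≤ v → IsIndexPolicy τ (best (update s i v)) (update s i v) (k v))
         × (v < V i → ThresholdPhase τ (j ∷ σ) V (update s i v) (k v)))

-- The shape of policy A described by T* (listed in the order σ) and thresholds V.
HasShape : ∀ {n} → (Fin n → ℚ) → List (Fin n) → (Fin n → ℚ) → Policy n → Set
HasShape τ [] V A = IsIndexPolicy τ 0ℚ initial A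
HasShape τ (i ∷ σ) V A = ThresholdPhase τ (i ∷ σ) V initial A

{-# OPTIONS --safe #-}
module Submission where

-- Let b be the best value seen so far and L the unopened boxes, and write
--   W(L, b) = 𝔼[b ⊔ max_{j ∈ L} (v_j ⊓ τ_j)],
--   A(L)    = max_{i ∈ L} (𝔼 v_i ⊔ (𝔼[A(L ∖ i) ⊔ W(L ∖ i, v_i)] − c_i)).
-- Every policy earns at most A(L) ⊔ W(L, b), by induction over its decision tree: opening i
-- earns at most 𝔼[A(L ∖ i) ⊔ W(L ∖ i, b ⊔ v_i)] − c_i, which is at most A(L) if
-- W(L ∖ i, b) ≤ A(L ∖ i), and otherwise at most W(L, b) because c_i = 𝔼[(v_i − τ_i)⁺]
-- (Weitzman's amortisation).  The index policy earns exactly W(L, b), so it is optimal when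
-- A(L) ≤ W(L, 0).  Otherwise A(L) is attained by taking blind or opening the box i achieving the
-- maximum, and after opening it switching to the index policy iff A(L ∖ i) ≤ W(L ∖ i, v_i) and
-- recursing on L ∖ i otherwise; since W is monotone in its second argument this switch is a
-- threshold on v_i.  Taking the last box blind beats opening it because c_i ≥ 0.

open import Defs
open import Data.Nat as ℕ using (ℕ; zero; suc)
import Data.Nat.Properties as ℕ
open import Data.Fin using (Fin; _≟_)
open import Data.Rational
  using (ℚ; 0ℚ; 1ℚ; _+_; _*_; _-_; -_; _⊔_; _⊓_; _≤_; _<_; _≤?_; _<?_; nonNegative)
open import Data.Rational.Properties hiding (_≟_)
open import Data.Rational.Solver using (module +-*-Solver)
open import Data.List using (List; []; _∷_; foldr; map; filter; length; allFin)
open import Data.List.Properties using (filter-accept; filter-reject; filter-all; filter-notAll)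
open import Data.List.Relation.Unary.All as All using (All; []; _∷_)
import Data.List.Relation.Unary.All.Properties as All
open import Data.List.Relation.Unary.Any as Any using (here; there)
open import Data.List.Relation.Unary.AllPairs using ([]; _∷_)
open import Data.List.Membership.Propositional using (_∈_; _∉_)
open import Data.List.Membership.Propositional.Properties
  using (∈-allFin; ∈-filter⁺; ∈-filter⁻; ∈-length)
open import Data.List.Relation.Unary.Unique.Propositional using (Unique)
import Data.List.Relation.Unary.Unique.Propositional.Properties as Unique
open import Relation.Binary.Bundles using (DecTotalOrder)
import Data.List.Extrema (DecTotalOrder.totalOrder ≤-decTotalOrder) as Extrema
open import Data.Maybe using (Maybe; just; nothing; maybe′)
open import Data.Product using (Σ; _×_; _,_; proj₁; proj₂)
open import Data.Sum using (_⊎_; inj₁; inj₂)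
open import Data.Bool using (if_then_else_)
open import Data.Unit using (⊤; tt)
open import Data.Empty using (⊥-elim)
open import Function using (case_of_)
open import Level using (0ℓ)
open import Relation.Nullary using (¬_; ¬?; Dec; does; yes; no)
open import Relation.Unary using (Pred; Decidable)
open import Relation.Binary.PropositionalEquality
open +-*-Solver

_⁺ : ℚ → ℚ
x ⁺ = x ⊔ 0ℚ

private
  p≤p+q : ∀ {p q} → 0ℚ ≤ q → p ≤ p + q
  p≤p+q {p} 0≤q = subst (_≤ p + _) (+-identityʳ p) (+-monoʳ-≤ p 0≤q)

  p≤q+r⇒p-r≤q : ∀ {p q} r → p ≤ q + r → p - r ≤ q
  p≤q+r⇒p-r≤q {p} {q} r p≤q+r =
    subst (p - r ≤_) (solve 2 (λ q r → (q :+ r) :- r := q) refl q r) (+-monoˡ-≤ (- r) p≤q+r)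

  p+r≤q⇒p≤q-r : ∀ {p q} r → p + r ≤ q → p ≤ q - r
  p+r≤q⇒p≤q-r {p} {q} r p+r≤q =
    subst (_≤ q - r) (solve 2 (λ p r → (p :+ r) :- r := p) refl p r) (+-monoˡ-≤ (- r) p+r≤q)

  p≡q+[p-q] : ∀ p q → p ≡ q + (p - q)
  p≡q+[p-q] = solve 2 (λ p q → p := q :+ (p :- q)) refl

  0≤p-q : ∀ {p q} → q ≤ p → 0ℚ ≤ p - q
  0≤p-q {p} {q} q≤p = subst (_≤ p - q) (+-inverseʳ q) (+-monoˡ-≤ (- q) q≤p)

  [p-q]⁺≡0 : ∀ {p q} → p ≤ q → (p - q) ⁺ ≡ 0ℚ
  [p-q]⁺≡0 {p} {q} p≤q = p≤q⇒p⊔q≡q (subst (p - q ≤_) (+-inverseʳ q) (+-monoˡ-≤ (- q) p≤q))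

private
  𝔼ₛ : List (ℚ × ℚ) → (ℚ → ℚ) → ℚ
  𝔼ₛ xs f = foldr (λ vp acc → proj₂ vp * f (proj₁ vp) + acc) 0ℚ xs

  mass : List (ℚ × ℚ) → ℚ
  mass = foldr (λ vp acc → proj₂ vp + acc) 0ℚ

  𝔼ₛ-cong : ∀ xs {f g : ℚ → ℚ} → (∀ v → f v ≡ g v) → 𝔼ₛ xs f ≡ 𝔼ₛ xs g
  𝔼ₛ-cong []             f≗g = refl
  𝔼ₛ-cong ((v , p) ∷ xs) f≗g = cong₂ (λ a b → p * a + b) (f≗g v) (𝔼ₛ-cong xs f≗g)

  𝔼ₛ-+ : ∀ xs (f g : ℚ → ℚ) → 𝔼ₛ xs (λ v → f v + g v) ≡ 𝔼ₛ xs f + 𝔼ₛ xs g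
  𝔼ₛ-+ []             f g = refl
  𝔼ₛ-+ ((v , p) ∷ xs) f g = trans (cong (p * (f v + g v) +_) (𝔼ₛ-+ xs f g))
    (solve 5 (λ p a b x y → p :* (a :+ b) :+ (x :+ y) := (p :* a :+ x) :+ (p :* b :+ y))
           refl p (f v) (g v) (𝔼ₛ xs f) (𝔼ₛ xs g))

  𝔼ₛ-scale : ∀ xs a (f : ℚ → ℚ) → 𝔼ₛ xs (λ v → a * f v) ≡ a * 𝔼ₛ xs f
  𝔼ₛ-scale []             a f = sym (*-zeroʳ a)
  𝔼ₛ-scale ((v , p) ∷ xs) a f = trans (cong (p * (a * f v) +_) (𝔼ₛ-scale xs a f))
    (solve 4 (λ p a b x → p :* (a :* b) :+ a :* x := a :* (p :* b :+ x)) refl p a (f v) (𝔼ₛ xs f))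

  𝔼ₛ-const : ∀ xs a → 𝔼ₛ xs (λ _ → a) ≡ a * mass xs
  𝔼ₛ-const []             a = sym (*-zeroʳ a)
  𝔼ₛ-const ((v , p) ∷ xs) a = trans (cong (p * a +_) (𝔼ₛ-const xs a))
    (solve 3 (λ p a m → p :* a :+ a :* m := a :* (p :+ m)) refl p a (mass xs))

  𝔼ₛ-fubini : ∀ xs ys (h : ℚ → ℚ → ℚ) →
    𝔼ₛ xs (λ x → 𝔼ₛ ys (h x)) ≡ 𝔼ₛ ys (λ y → 𝔼ₛ xs (λ x → h x y))
  𝔼ₛ-fubini []             ys h = sym (trans (𝔼ₛ-const ys 0ℚ) (*-zeroˡ (mass ys)))
  𝔼ₛ-fubini ((x , p) ∷ xs) ys h = begin
      p * 𝔼ₛ ys (h x) + 𝔼ₛ xs (λ x′ → 𝔼ₛ ys (h x′))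
    ≡⟨ cong₂ _+_ (sym (𝔼ₛ-scale ys p (h x))) (𝔼ₛ-fubini xs ys h) ⟩
      𝔼ₛ ys (λ y → p * h x y) + 𝔼ₛ ys (λ y → 𝔼ₛ xs (λ x′ → h x′ y))
    ≡⟨ sym (𝔼ₛ-+ ys _ _) ⟩
      𝔼ₛ ys (λ y → p * h x y + 𝔼ₛ xs (λ x′ → h x′ y)) ∎
    where open ≡-Reasoning

  𝔼ₛ-mono : ∀ xs {f g : ℚ → ℚ} → All (λ vp → 0ℚ ≤ proj₂ vp) xs →
    All (λ vp → f (proj₁ vp) ≤ g (proj₁ vp)) xs → 𝔼ₛ xs f ≤ 𝔼ₛ xs g
  𝔼ₛ-mono []             []         []         = ≤-refl
  𝔼ₛ-mono ((v , p) ∷ xs) (p≥0 ∷ ps) (f≤g ∷ hs) =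
    +-mono-≤ (*-monoˡ-≤-nonNeg p {{nonNegative p≥0}} f≤g) (𝔼ₛ-mono xs ps hs)

𝔼-cong : ∀ F {f g : ℚ → ℚ} → (∀ v → f v ≡ g v) → 𝔼 F f ≡ 𝔼 F g
𝔼-cong F = 𝔼ₛ-cong (support F)

𝔼-const : ∀ F a → 𝔼 F (λ _ → a) ≡ a
𝔼-const F a = trans (𝔼ₛ-const (support F) a) (trans (cong (a *_) (probsSum1 F)) (*-identityʳ a))

𝔼-+ : ∀ F (f g : ℚ → ℚ) → 𝔼 F (λ v → f v + g v) ≡ 𝔼 F f + 𝔼 F g
𝔼-+ F = 𝔼ₛ-+ (support F)

𝔼-+-const : ∀ F (f : ℚ → ℚ) a → 𝔼 F (λ v → f v + a) ≡ 𝔼 F f + a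
𝔼-+-const F f a = trans (𝔼-+ F f (λ _ → a)) (cong (𝔼 F f +_) (𝔼-const F a))

𝔼-fubini : ∀ F G (h : ℚ → ℚ → ℚ) → 𝔼 F (λ x → 𝔼 G (h x)) ≡ 𝔼 G (λ y → 𝔼 F (λ x → h x y))
𝔼-fubini F G = 𝔼ₛ-fubini (support F) (support G)

𝔼-mono-support : ∀ F {f g : ℚ → ℚ} → All (λ vp → f (proj₁ vp) ≤ g (proj₁ vp)) (support F) →
  𝔼 F f ≤ 𝔼 F g
𝔼-mono-support F = 𝔼ₛ-mono (support F) (probs≥0 F)

𝔼-mono : ∀ F {f g : ℚ → ℚ} → (∀ v → f v ≤ g v) → 𝔼 F f ≤ 𝔼 F g
𝔼-mono F f≤g = 𝔼-mono-support F (All.universal (λ vp → f≤g (proj₁ vp)) (support F))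

𝔼-mono-nonNeg : ∀ F {f g : ℚ → ℚ} → (∀ v → 0ℚ ≤ v → f v ≤ g v) → 𝔼 F f ≤ 𝔼 F g
𝔼-mono-nonNeg F f≤g = 𝔼-mono-support F (All.map (f≤g _) (values≥0 F))

𝔼-nonNeg : ∀ F → 0ℚ ≤ 𝔼 F (λ v → v)
𝔼-nonNeg F = subst (_≤ 𝔼 F (λ v → v)) (𝔼-const F 0ℚ) (𝔼-mono-nonNeg F (λ _ v≥0 → v≥0))

update-other : ∀ {n} (s : State n) i v {j} → ¬ j ≡ i → update s i v j ≡ s j
update-other s i v {j} j≢i with j ≟ i
... | yes j≡i = ⊥-elim (j≢i j≡i)
... | no _    = refl

private
  revealedFrom : ∀ {n} → State n → List (Fin n) → List ℚ
  revealedFrom s = foldr (λ j vs → maybe′ (_∷ vs) vs (s j)) []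

  -- h and h′ stand for the local helper of `revealed` and its `with`-function, which cannot be
  -- named outside Defs; they are found by unification when their equations are proved by `refl`.
  revealed-helper : ∀ {n} (s : State n) (h : List (Fin n) → List ℚ)
    (h′ : Fin n → List (Fin n) → Maybe ℚ → List ℚ) →
    h [] ≡ [] → (∀ j js → h (j ∷ js) ≡ h′ j js (s j)) →
    (∀ j js v → h′ j js (just v) ≡ v ∷ h js) → (∀ j js → h′ j js nothing ≡ h js) →
    ∀ j js m → h′ j js m ≡ maybe′ (_∷ revealedFrom s js) (revealedFrom s js) m
  revealed-helper s h h′ h-[] h-∷ h′-just h′-nothing = h′≡
    where
    h≡  : ∀ js → h js ≡ revealedFrom s js
    h′≡ : ∀ j js m → h′ j js m ≡ maybe′ (_∷ revealedFrom s js) (revealedFrom s js) m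
    h≡ []       = h-[]
    h≡ (j ∷ js) = trans (h-∷ j js) (h′≡ j js (s j))
    h′≡ j js (just v) = trans (h′-just j js v) (cong (v ∷_) (h≡ js))
    h′≡ j js nothing  = trans (h′-nothing j js) (h≡ js)

  revealed≡revealedFrom : ∀ {n} (s : State n) → revealed s ≡ revealedFrom s (allFin n)
  revealed≡revealedFrom {n} s
    with allFin n | revealed-helper s _ _ refl (λ _ _ → refl) (λ _ _ _ → refl) (λ _ _ → refl)
  ... | []     | _   = refl
  ... | j ∷ js | h′≡ with s j
  ...   | m = h′≡ j js m

maxList-nonNeg : ∀ vs → 0ℚ ≤ maxList vs
maxList-nonNeg []       = ≤-refl
maxList-nonNeg (v ∷ vs) = ≤-trans (maxList-nonNeg vs) (p≤q⊔p v (maxList vs))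

best-nonNeg : ∀ {n} (s : State n) → 0ℚ ≤ best s
best-nonNeg s = maxList-nonNeg (revealed s)

module _ {n : ℕ} (s : State n) (i : Fin n) (v : ℚ) (unopened : s i ≡ nothing) where

  private
    s′ = update s i v

    ⊔-revealed-update : ∀ js → maxList (revealedFrom s′ js) ⊔ v ≡ maxList (revealedFrom s js) ⊔ v
    ⊔-revealed-update []       = refl
    ⊔-revealed-update (j ∷ js) with j ≟ i
    ... | yes refl rewrite unopened = begin
          (v ⊔ m′) ⊔ v ≡⟨ cong (_⊔ v) (⊔-comm v m′) ⟩
          (m′ ⊔ v) ⊔ v ≡⟨ ⊔-assoc m′ v v ⟩
          m′ ⊔ (v ⊔ v) ≡⟨ cong (m′ ⊔_) (⊔-idem v) ⟩
          m′ ⊔ v       ≡⟨ ⊔-revealed-update js ⟩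
          maxList (revealedFrom s js) ⊔ v ∎
      where open ≡-Reasoning
            m′ = maxList (revealedFrom s′ js)
    ... | no _ with s j
    ...   | nothing = ⊔-revealed-update js
    ...   | just w  = trans (⊔-assoc w _ v)
                        (trans (cong (w ⊔_) (⊔-revealed-update js)) (sym (⊔-assoc w _ v)))

    ≤-revealed-update : ∀ js → i ∈ js → v ≤ maxList (revealedFrom s′ js)
    ≤-revealed-update (j ∷ js) i∈ with j ≟ i | i∈
    ... | yes refl | _          = p≤p⊔q v _
    ... | no j≢i   | here i≡j   = ⊥-elim (j≢i (sym i≡j))
    ... | no _     | there i∈js with s j
    ...   | nothing = ≤-revealed-update js i∈js
    ...   | just w  = ≤-trans (≤-revealed-update js i∈js) (p≤q⊔p w _)

  best-update : best s′ ≡ best s ⊔ v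
  best-update = begin
      best s′
    ≡⟨ cong maxList (revealed≡revealedFrom s′) ⟩
      maxList (revealedFrom s′ (allFin n))
    ≡⟨ sym (p≥q⇒p⊔q≡p (≤-revealed-update (allFin n) (∈-allFin i))) ⟩
      maxList (revealedFrom s′ (allFin n)) ⊔ v
    ≡⟨ ⊔-revealed-update (allFin n) ⟩
      maxList (revealedFrom s (allFin n)) ⊔ v
    ≡⟨ cong (λ vs → maxList vs ⊔ v) (sym (revealed≡revealedFrom s)) ⟩
      best s ⊔ v ∎
    where open ≡-Reasoning

  ≤-best-update : v ≤ best s′
  ≤-best-update = ≤-trans (p≤q⊔p (best s) v) (≤-reflexive (sym best-update))

remove : ∀ {n} → Fin n → List (Fin n) → List (Fin n)
remove i = filter (λ j → ¬? (j ≟ i))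

module _ {n : ℕ} {i : Fin n} where

  ∈-remove⁺ : ∀ {j L} → j ∈ L → ¬ j ≡ i → j ∈ remove i L
  ∈-remove⁺ = ∈-filter⁺ (λ j → ¬? (j ≟ i))

  ∈-remove⁻ : ∀ {j L} → j ∈ remove i L → j ∈ L × (¬ j ≡ i)
  ∈-remove⁻ = ∈-filter⁻ (λ j → ¬? (j ≟ i))

  remove⁺ : ∀ {P : Fin n → Set} {L} → All P L → All P (remove i L)
  remove⁺ = All.filter⁺ (λ j → ¬? (j ≟ i))

  remove-∉ : ∀ {L} → i ∉ L → remove i L ≡ L
  remove-∉ i∉L =
    filter-all (λ j → ¬? (j ≟ i)) (All.tabulate λ j∈L j≡i → i∉L (subst (_∈ _) j≡i j∈L))

  remove-∷-same : ∀ L → i ∉ L → remove i (i ∷ L) ≡ L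
  remove-∷-same L i∉L = trans (filter-reject (λ j → ¬? (j ≟ i)) (λ i≢i → i≢i refl)) (remove-∉ i∉L)

  remove-∷-other : ∀ {j} L → ¬ j ≡ i → remove i (j ∷ L) ≡ j ∷ remove i L
  remove-∷-other L = filter-accept (λ j → ¬? (j ≟ i))

  length-remove : ∀ {k L} → length L ℕ.≤ suc k → i ∈ L → length (remove i L) ℕ.≤ k
  length-remove {L = L} len i∈L = ℕ.≤-pred (ℕ.≤-trans shorter len)
    where shorter = filter-notAll (λ j → ¬? (j ≟ i)) L (Any.map (λ i≡j j≢i → j≢i (sym i≡j)) i∈L)

record Unopened {n} (s : State n) (L : List (Fin n)) : Set where
  field
    unique     : Unique L
    ∈⇒unopened : ∀ {j} → j ∈ L → s j ≡ nothing
    unopened⇒∈ : ∀ {j} → s j ≡ nothing → j ∈ L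

unopened-initial : ∀ {n} → Unopened (initial {n}) (allFin n)
unopened-initial {n} = record
  { unique = Unique.allFin⁺ n ; ∈⇒unopened = λ _ → refl ; unopened⇒∈ = λ {j} _ → ∈-allFin j }

unopened-update : ∀ {n} {s : State n} {L i} v → Unopened s L → i ∈ L →
  Unopened (update s i v) (remove i L)
unopened-update {s = s} {L} {i} v U i∈L = record
  { unique     = Unique.filter⁺ (λ j → ¬? (j ≟ i)) (Unopened.unique U)
  ; ∈⇒unopened = λ j∈ → let j∈L , j≢i = ∈-remove⁻ j∈ in
                   trans (update-other s i v j≢i) (Unopened.∈⇒unopened U j∈L)
  ; unopened⇒∈ = unopened⇒∈
  }
  where
  unopened⇒∈ : ∀ {j} → update s i v j ≡ nothing → j ∈ remove i L
  unopened⇒∈ {j} e with j ≟ i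
  ... | yes _  = case e of λ ()
  ... | no j≢i = ∈-remove⁺ (Unopened.unopened⇒∈ U e) j≢i

unopened-length : ∀ {n} {s : State n} {L i} → Unopened s L → s i ≡ nothing → 0 ℕ.< length L
unopened-length U unopened = ∈-length (Unopened.unopened⇒∈ U unopened)

strictUpperBound : List ℚ → ℚ
strictUpperBound []       = 0ℚ
strictUpperBound (v ∷ vs) = (v + 1ℚ) ⊔ strictUpperBound vs

<-strictUpperBound : ∀ vs → All (_< strictUpperBound vs) vs
<-strictUpperBound []       = []
<-strictUpperBound (v ∷ vs) = <-≤-trans v<v+1 (p≤p⊔q (v + 1ℚ) _)
  ∷ All.map (λ w< → <-≤-trans w< (p≤q⊔p (v + 1ℚ) _)) (<-strictUpperBound vs)
  where v<v+1 = subst (_< v + 1ℚ) (+-identityʳ v) (+-monoʳ-< v (positive⁻¹ 1ℚ))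

module _ {P : Pred ℚ 0ℓ} (P? : Decidable P) (P-mono : ∀ {u v} → u ≤ v → P u → P v) where

  private
    minSatisfying : ℚ → List ℚ → ℚ
    minSatisfying top []       = top
    minSatisfying top (v ∷ vs) =
      if does (P? v) then v ⊓ minSatisfying top vs else minSatisfying top vs

    minSatisfying-≤ : ∀ top vs → All (λ v → P v → minSatisfying top vs ≤ v) vs
    minSatisfying-≤ top []       = []
    minSatisfying-≤ top (v ∷ vs) with P? v
    ... | yes _  = (λ _ → p⊓q≤p v _)
                 ∷ All.map (λ ≤w Pw → ≤-trans (p⊓q≤q v _) (≤w Pw)) (minSatisfying-≤ top vs)
    ... | no ¬Pv = (λ Pv → ⊥-elim (¬Pv Pv)) ∷ minSatisfying-≤ top vs

    minSatisfying-sat : ∀ top vs → P (minSatisfying top vs) ⊎ minSatisfying top vs ≡ top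
    minSatisfying-sat top []       = inj₂ refl
    minSatisfying-sat top (v ∷ vs) with P? v
    ... | no _  = minSatisfying-sat top vs
    ... | yes Pv with ⊓-sel v (minSatisfying top vs)
    ...   | inj₁ ≡v = inj₁ (subst P (sym ≡v) Pv)
    ...   | inj₂ ≡m = subst (λ t → P t ⊎ t ≡ top) (sym ≡m) (minSatisfying-sat top vs)

  threshold : List ℚ → ℚ
  threshold vs = minSatisfying (strictUpperBound vs) vs

  threshold-separates : ∀ vs → All (λ v → (threshold vs ≤ v → P v) × (v < threshold vs → ¬ P v)) vs
  threshold-separates vs = All.zipWith separates (minSatisfying-≤ top vs , <-strictUpperBound vs)
    where
    top = strictUpperBound vs
    separates : ∀ {v} → (P v → threshold vs ≤ v) × v < top →
      (threshold vs ≤ v → P v) × (v < threshold vs → ¬ P v)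
    separates {v} (≤v , v<top) = above , λ v<t Pv → <-irrefl refl (<-≤-trans v<t (≤v Pv))
      where
      above : threshold vs ≤ v → P v
      above t≤v with minSatisfying-sat top vs
      ... | inj₁ Pt    = P-mono t≤v Pt
      ... | inj₂ t≡top = ⊥-elim (<-irrefl refl (<-≤-trans v<top (subst (_≤ v) t≡top t≤v)))

module IndexValue {n : ℕ} (F : Fin n → Dist) (τ : Fin n → ℚ) where

  capped : Fin n → ℚ → ℚ
  capped j v = v ⊓ τ j

  -- W(L, b) of the header.
  indexValue : List (Fin n) → ℚ → ℚ
  indexValue []      b = b
  indexValue (j ∷ L) b = 𝔼 (F j) (λ v → indexValue L (b ⊔ capped j v))

  indexValue-≥ : ∀ L b → b ≤ indexValue L b
  indexValue-≥ []      b = ≤-refl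
  indexValue-≥ (j ∷ L) b = subst (_≤ indexValue (j ∷ L) b) (𝔼-const (F j) b)
    (𝔼-mono (F j) (λ v → ≤-trans (p≤p⊔q b (capped j v)) (indexValue-≥ L (b ⊔ capped j v))))

  indexValue-mono : ∀ L {b b′} → b ≤ b′ → indexValue L b ≤ indexValue L b′
  indexValue-mono []      b≤b′ = b≤b′
  indexValue-mono (j ∷ L) b≤b′ =
    𝔼-mono (F j) (λ v → indexValue-mono L (⊔-monoˡ-≤ (capped j v) b≤b′))

  indexValue-lipschitz : ∀ L {b b′ d} → 0ℚ ≤ d → b′ ≤ b + d → indexValue L b′ ≤ indexValue L b + d
  indexValue-lipschitz []      0≤d b′≤b+d = b′≤b+d
  indexValue-lipschitz (j ∷ L) {b} {b′} {d} 0≤d b′≤b+d =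
    subst (indexValue (j ∷ L) b′ ≤_) (𝔼-+-const (F j) _ d)
      (𝔼-mono (F j) λ v → indexValue-lipschitz L 0≤d
        (⊔-lub (≤-trans b′≤b+d (+-monoˡ-≤ d (p≤p⊔q b (capped j v))))
               (≤-trans (p≤q⊔p b (capped j v)) (p≤p+q 0≤d))))

  indexValue-≡ : ∀ L b → All (λ j → τ j ≤ b) L → indexValue L b ≡ b
  indexValue-≡ []      b []           = refl
  indexValue-≡ (j ∷ L) b (τⱼ≤b ∷ τ≤b) = trans
    (𝔼-cong (F j) λ v → trans (cong (indexValue L) (p≥q⇒p⊔q≡p (≤-trans (p⊓q≤q v (τ j)) τⱼ≤b)))
                              (indexValue-≡ L b τ≤b))
    (𝔼-const (F j) b)

  indexValue-remove : ∀ L i b → Unique L → i ∈ L →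
    indexValue L b ≡ 𝔼 (F i) (λ v → indexValue (remove i L) (b ⊔ capped i v))
  indexValue-remove (i ∷ L) i b (i∉L ∷ _) (here refl) =
    cong (λ L′ → 𝔼 (F i) (λ v → indexValue L′ (b ⊔ capped i v)))
         (sym (remove-∷-same L (All.All¬⇒¬Any i∉L)))
  indexValue-remove (j ∷ L) i b (j∉L ∷ uL) (there i∈L) = begin
      𝔼 (F j) (λ w → indexValue L (b ⊔ capped j w))
    ≡⟨ 𝔼-cong (F j) (λ w → indexValue-remove L i (b ⊔ capped j w) uL i∈L) ⟩
      𝔼 (F j) (λ w → 𝔼 (F i) (λ v → indexValue (remove i L) ((b ⊔ capped j w) ⊔ capped i v)))
    ≡⟨ 𝔼-fubini (F j) (F i) _ ⟩
      𝔼 (F i) (λ v → 𝔼 (F j) (λ w → indexValue (remove i L) ((b ⊔ capped j w) ⊔ capped i v)))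
    ≡⟨ 𝔼-cong (F i) (λ v → 𝔼-cong (F j) (λ w → cong (indexValue (remove i L)) (⊔-swap b _ _))) ⟩
      𝔼 (F i) (λ v → 𝔼 (F j) (λ w → indexValue (remove i L) ((b ⊔ capped i v) ⊔ capped j w)))
    ≡⟨ cong (λ L′ → 𝔼 (F i) (λ v → indexValue L′ (b ⊔ capped i v)))
            (sym (remove-∷-other L (All.lookup j∉L i∈L))) ⟩
      𝔼 (F i) (λ v → indexValue (remove i (j ∷ L)) (b ⊔ capped i v)) ∎
    where
    open ≡-Reasoning
    ⊔-swap : ∀ x y z → (x ⊔ y) ⊔ z ≡ (x ⊔ z) ⊔ y
    ⊔-swap x y z = trans (⊔-assoc x y z) (trans (cong (x ⊔_) (⊔-comm y z)) (sym (⊔-assoc x z y)))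

module Pandora {n : ℕ} (c : Fin n → ℚ) (F : Fin n → Dist) (τ : Fin n → ℚ)
               (isIndex : ∀ i → IsIndex (F i) (c i) (τ i)) where

  open IndexValue F τ public

  𝔼-+-cost : ∀ i (f : ℚ → ℚ) → 𝔼 (F i) (λ v → f v + (v - τ i) ⁺) ≡ 𝔼 (F i) f + c i
  𝔼-+-cost i f = trans (𝔼-+ (F i) f _) (cong (𝔼 (F i) f +_) (isIndex i))

  module _ (L : List (Fin n)) (i : Fin n) (b : ℚ) where

    private
      capped-below : ∀ {v} → v ≤ τ i →
        indexValue L (b ⊔ capped i v) + (v - τ i) ⁺ ≡ indexValue L (b ⊔ v)
      capped-below {v} v≤τ = trans
        (cong₂ (λ x y → indexValue L (b ⊔ x) + y) (p≤q⇒p⊓q≡p v≤τ) ([p-q]⁺≡0 v≤τ))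
        (+-identityʳ _)

    probe-≤-capped :
      𝔼 (F i) (λ v → indexValue L (b ⊔ v)) - c i ≤ 𝔼 (F i) (λ v → indexValue L (b ⊔ capped i v))
    probe-≤-capped = p≤q+r⇒p-r≤q (c i)
      (subst (𝔼 (F i) (λ v → indexValue L (b ⊔ v)) ≤_) (𝔼-+-cost i _) (𝔼-mono (F i) pointwise))
      where
      pointwise : ∀ v → indexValue L (b ⊔ v) ≤ indexValue L (b ⊔ capped i v) + (v - τ i) ⁺
      pointwise v with ≤-total v (τ i)
      ... | inj₁ v≤τ = ≤-reflexive (sym (capped-below v≤τ))
      ... | inj₂ τ≤v rewrite p≥q⇒p⊓q≡q τ≤v | p≥q⇒p⊔q≡p (0≤p-q τ≤v) =
        indexValue-lipschitz L (0≤p-q τ≤v)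
          (⊔-lub (≤-trans (p≤p⊔q b (τ i)) (p≤p+q (0≤p-q τ≤v)))
                 (subst (_≤ (b ⊔ τ i) + (v - τ i)) (sym (p≡q+[p-q] v (τ i)))
                        (+-monoˡ-≤ (v - τ i) (p≤q⊔p b (τ i)))))

    capped-≤-probe : b ≤ τ i → All (λ j → τ j ≤ τ i) L →
      𝔼 (F i) (λ v → indexValue L (b ⊔ capped i v)) ≤ 𝔼 (F i) (λ v → indexValue L (b ⊔ v)) - c i
    capped-≤-probe b≤τ τ≤τᵢ = p+r≤q⇒p≤q-r (c i)
      (subst (_≤ 𝔼 (F i) (λ v → indexValue L (b ⊔ v))) (𝔼-+-cost i _) (𝔼-mono (F i) pointwise))
      where
      pointwise : ∀ v → indexValue L (b ⊔ capped i v) + (v - τ i) ⁺ ≤ indexValue L (b ⊔ v)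
      pointwise v with ≤-total v (τ i)
      ... | inj₁ v≤τ = ≤-reflexive (capped-below v≤τ)
      ... | inj₂ τ≤v = ≤-reflexive (begin
            indexValue L (b ⊔ capped i v) + (v - τ i) ⁺
          ≡⟨ cong₂ (λ x y → indexValue L (b ⊔ x) + y) (p≥q⇒p⊓q≡q τ≤v) (p≥q⇒p⊔q≡p (0≤p-q τ≤v)) ⟩
            indexValue L (b ⊔ τ i) + (v - τ i)
          ≡⟨ cong (λ x → indexValue L x + (v - τ i)) (p≤q⇒p⊔q≡q b≤τ) ⟩
            indexValue L (τ i) + (v - τ i)
          ≡⟨ cong (_+ (v - τ i)) (indexValue-≡ L (τ i) τ≤τᵢ) ⟩
            τ i + (v - τ i)
          ≡⟨ sym (p≡q+[p-q] v (τ i)) ⟩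
            v
          ≡⟨ sym (indexValue-≡ L v (All.map (λ τⱼ≤τᵢ → ≤-trans τⱼ≤τᵢ τ≤v) τ≤τᵢ)) ⟩
            indexValue L v
          ≡⟨ cong (indexValue L) (sym (p≤q⇒p⊔q≡q (≤-trans b≤τ τ≤v))) ⟩
            indexValue L (b ⊔ v) ∎)
        where open ≡-Reasoning

  takeValue : Fin n → ℚ
  takeValue i = 𝔼 (F i) (λ v → v)

  -- A(L) of the header, computed with fuel k ≥ length L.
  thresholdValue : ℕ → List (Fin n) → ℚ
  probeValue     : ℕ → List (Fin n) → Fin n → ℚ
  startValue     : ℕ → List (Fin n) → Fin n → ℚ
  firstBox       : ℕ → Fin n → List (Fin n) → Fin n

  thresholdValue k       []       = 0ℚ
  thresholdValue zero    (x ∷ xs) = 0ℚ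
  thresholdValue (suc k) (x ∷ xs) = startValue k (x ∷ xs) (firstBox k x xs)

  probeValue k L i =
    𝔼 (F i) (λ v → thresholdValue k (remove i L) ⊔ indexValue (remove i L) v) - c i

  startValue k L i = takeValue i ⊔ probeValue k L i

  firstBox k x xs = Extrema.argmax (startValue k (x ∷ xs)) x xs

  firstBox-∈ : ∀ k x xs → firstBox k x xs ∈ x ∷ xs
  firstBox-∈ k x xs with Extrema.argmax-sel (startValue k (x ∷ xs)) x xs
  ... | inj₁ ≡x  = here ≡x
  ... | inj₂ ∈xs = there ∈xs

  startValue-≤-thresholdValue : ∀ k {i L} → i ∈ L → startValue k L i ≤ thresholdValue (suc k) L
  startValue-≤-thresholdValue k {L = x ∷ xs} (here refl) =
    Extrema.f[⊥]≤f[argmax] {f = startValue k (x ∷ xs)} x xs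
  startValue-≤-thresholdValue k {L = x ∷ xs} (there i∈xs) =
    All.lookup (Extrema.f[xs]≤f[argmax] {f = startValue k (x ∷ xs)} x xs) i∈xs

  optimalValue : ℕ → List (Fin n) → ℚ → ℚ
  optimalValue k L b = thresholdValue k L ⊔ indexValue L b

  probe-≤-startValue : ∀ k {L i} b → indexValue (remove i L) b ≤ thresholdValue k (remove i L) →
    𝔼 (F i) (λ v → optimalValue k (remove i L) (b ⊔ v)) - c i ≤ startValue k L i
  probe-≤-startValue k {L} {i} b index≤threshold =
    ≤-trans (+-monoˡ-≤ (- c i) (𝔼-mono (F i) pointwise)) (p≤q⊔p (takeValue i) _)
    where
    L′ = remove i L
    pointwise : ∀ v → optimalValue k L′ (b ⊔ v) ≤ optimalValue k L′ v
    pointwise v with ≤-total v b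
    ... | inj₁ v≤b = ⊔-lub (p≤p⊔q (thresholdValue k L′) (indexValue L′ v)) (begin
          indexValue L′ (b ⊔ v) ≡⟨ cong (indexValue L′) (p≥q⇒p⊔q≡p v≤b) ⟩
          indexValue L′ b       ≤⟨ index≤threshold ⟩
          thresholdValue k L′   ≤⟨ p≤p⊔q (thresholdValue k L′) (indexValue L′ v) ⟩
          optimalValue k L′ v   ∎)
      where open ≤-Reasoning
    ... | inj₂ b≤v = ≤-reflexive (cong (optimalValue k L′) (p≤q⇒p⊔q≡q b≤v))

  probe-≤-indexValue : ∀ k {L i} b → Unique L → i ∈ L →
    thresholdValue k (remove i L) ≤ indexValue (remove i L) b →
    𝔼 (F i) (λ v → optimalValue k (remove i L) (b ⊔ v)) - c i ≤ indexValue L b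
  probe-≤-indexValue k {L} {i} b uL i∈L threshold≤index = begin
      𝔼 (F i) (λ v → optimalValue k L′ (b ⊔ v)) - c i ≤⟨ +-monoˡ-≤ (- c i) (𝔼-mono (F i) pointwise) ⟩
      𝔼 (F i) (λ v → indexValue L′ (b ⊔ v)) - c i     ≤⟨ probe-≤-capped L′ i b ⟩
      𝔼 (F i) (λ v → indexValue L′ (b ⊔ capped i v))  ≡⟨ indexValue-remove L i b uL i∈L ⟨
      indexValue L b                                 ∎
    where
    open ≤-Reasoning
    L′ = remove i L
    pointwise : ∀ v → optimalValue k L′ (b ⊔ v) ≤ indexValue L′ (b ⊔ v)
    pointwise v = ⊔-lub (≤-trans threshold≤index (indexValue-mono L′ (p≤p⊔q b v))) ≤-refl

  probe-≤-optimalValue : ∀ k {L i} b → Unique L → i ∈ L →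
    𝔼 (F i) (λ v → optimalValue k (remove i L) (b ⊔ v)) - c i ≤ optimalValue (suc k) L b
  probe-≤-optimalValue k {L} {i} b uL i∈L
    with ≤-total (indexValue (remove i L) b) (thresholdValue k (remove i L))
  ... | inj₁ index≤threshold = ≤-trans (probe-≤-startValue k {L} b index≤threshold)
          (≤-trans (startValue-≤-thresholdValue k i∈L) (p≤p⊔q _ (indexValue L b)))
  ... | inj₂ threshold≤index = ≤-trans (probe-≤-indexValue k {L} b uL i∈L threshold≤index)
          (p≤q⊔p (thresholdValue (suc k) L) _)

  payoff-≤-optimalValue : ∀ k {s L} → Unopened s L → length L ℕ.≤ k →
    ∀ P → Valid s P → payoff c F s P ≤ optimalValue k L (best s)
  payoff-≤-optimalValue k {s} {L} U len stop _ =
    ≤-trans (indexValue-≥ L (best s)) (p≤q⊔p (thresholdValue k L) _)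
  payoff-≤-optimalValue zero U len (takeBox i) unopened =
    ⊥-elim (ℕ.n≮0 (ℕ.<-≤-trans (unopened-length U unopened) len))
  payoff-≤-optimalValue zero U len (openBox i _) (unopened , _) =
    ⊥-elim (ℕ.n≮0 (ℕ.<-≤-trans (unopened-length U unopened) len))
  payoff-≤-optimalValue (suc k) U len (takeBox i) unopened = ≤-trans (p≤p⊔q _ _)
    (≤-trans (startValue-≤-thresholdValue k (Unopened.unopened⇒∈ U unopened)) (p≤p⊔q _ _))
  payoff-≤-optimalValue (suc k) {s} {L} U len (openBox i next) (unopened , valid) = begin
      𝔼 (F i) (λ v → payoff c F (update s i v) (next v)) - c i
    ≤⟨ +-monoˡ-≤ (- c i) (𝔼-mono (F i) continue) ⟩
      𝔼 (F i) (λ v → optimalValue k (remove i L) (best s ⊔ v)) - c i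
    ≤⟨ probe-≤-optimalValue k (best s) (Unopened.unique U) i∈L ⟩
      optimalValue (suc k) L (best s) ∎
    where
    open ≤-Reasoning
    i∈L = Unopened.unopened⇒∈ U unopened
    continue : ∀ v → payoff c F (update s i v) (next v) ≤ optimalValue k (remove i L) (best s ⊔ v)
    continue v = subst (payoff c F (update s i v) (next v) ≤_)
      (cong (optimalValue k (remove i L)) (best-update s i v unopened))
      (payoff-≤-optimalValue k (unopened-update v U i∈L) (length-remove len i∈L) (next v) (valid v))

  topIndex : Fin n → List (Fin n) → Fin n
  topIndex = Extrema.argmax τ

  topIndex-∈ : ∀ x xs → topIndex x xs ∈ x ∷ xs
  topIndex-∈ x xs with Extrema.argmax-sel τ x xs
  ... | inj₁ ≡x  = here ≡x
  ... | inj₂ ∈xs = there ∈xs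

  τ≤τ[topIndex] : ∀ x xs → All (λ j → τ j ≤ τ (topIndex x xs)) (x ∷ xs)
  τ≤τ[topIndex] x xs = Extrema.f[⊥]≤f[argmax] {f = τ} x xs ∷ Extrema.f[xs]≤f[argmax] x xs

  indexPolicy : ℚ → ℕ → List (Fin n) → State n → Policy n
  indexPolicy w zero    L        s = stop
  indexPolicy w (suc k) []       s = stop
  indexPolicy w (suc k) (x ∷ xs) s with w ⊔ best s <? τ (topIndex x xs)
  ... | yes _ = openBox m (λ v → indexPolicy w k (remove m (x ∷ xs)) (update s m v))
    where m = topIndex x xs
  ... | no _  = stop

  indexPolicy-shape : ∀ w k {s L} → Unopened s L → length L ℕ.≤ k →
    IsIndexPolicy τ w s (indexPolicy w k L s)
  indexPolicy-shape w zero    {L = []} U len j unopened = case Unopened.unopened⇒∈ U unopened of λ ()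
  indexPolicy-shape w (suc k) {L = []} U len j unopened = case Unopened.unopened⇒∈ U unopened of λ ()
  indexPolicy-shape w (suc k) {s} {x ∷ xs} U len with w ⊔ best s <? τ (topIndex x xs)
  ... | yes w<τ = Unopened.∈⇒unopened U m∈L , τ≤τₘ , w<τ ,
      λ v → indexPolicy-shape w k (unopened-update v U m∈L) (length-remove len m∈L)
    where
    m∈L = topIndex-∈ x xs
    τ≤τₘ = λ j unopened → All.lookup (τ≤τ[topIndex] x xs) (Unopened.unopened⇒∈ U unopened)
  ... | no w≮τ = λ j unopened →
      ≤-trans (All.lookup (τ≤τ[topIndex] x xs) (Unopened.unopened⇒∈ U unopened)) (≮⇒≥ w≮τ)

  indexPolicy-valid : ∀ w {s} P → IsIndexPolicy τ w s P → Valid s P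
  indexPolicy-valid w stop          _                         = tt
  indexPolicy-valid w (openBox i k) (unopened , _ , _ , next) =
    unopened , λ v → indexPolicy-valid w (k v) (next v)

  indexValue-≤-payoff : ∀ w k {s L} → Unopened s L → length L ℕ.≤ k → w ≤ best s →
    indexValue L (best s) ≤ payoff c F s (indexPolicy w k L s)
  indexValue-≤-payoff w zero    {L = []} U len w≤b = ≤-refl
  indexValue-≤-payoff w (suc k) {L = []} U len w≤b = ≤-refl
  indexValue-≤-payoff w (suc k) {s} {x ∷ xs} U len w≤b with w ⊔ best s <? τ (topIndex x xs)
  ... | yes w<τ = begin
      indexValue L b
    ≡⟨ indexValue-remove L m b (Unopened.unique U) m∈L ⟩
      𝔼 (F m) (λ v → indexValue L′ (b ⊔ capped m v))
    ≤⟨ capped-≤-probe L′ m b (≤-trans (p≤q⊔p w b) (<⇒≤ w<τ)) (remove⁺ (τ≤τ[topIndex] x xs)) ⟩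
      𝔼 (F m) (λ v → indexValue L′ (b ⊔ v)) - c m
    ≤⟨ +-monoˡ-≤ (- c m) (𝔼-mono (F m) continue) ⟩
      𝔼 (F m) (λ v → payoff c F (update s m v) (indexPolicy w k L′ (update s m v))) - c m ∎
    where
    open ≤-Reasoning
    L = x ∷ xs
    m = topIndex x xs
    b = best s
    L′ = remove m L
    m∈L = topIndex-∈ x xs
    unopened = Unopened.∈⇒unopened U m∈L
    continue : ∀ v → indexValue L′ (b ⊔ v) ≤ payoff c F (update s m v) (indexPolicy w k L′ (update s m v))
    continue v = begin
        indexValue L′ (b ⊔ v)
      ≡⟨ cong (indexValue L′) (sym (best-update s m v unopened)) ⟩
        indexValue L′ (best (update s m v))
      ≤⟨ indexValue-≤-payoff w k (unopened-update v U m∈L) (length-remove len m∈L)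
           (≤-trans w≤b (≤-trans (p≤p⊔q b v) (≤-reflexive (sym (best-update s m v unopened))))) ⟩
        payoff c F (update s m v) (indexPolicy w k L′ (update s m v)) ∎
  ... | no w≮τ = ≤-reflexive (indexValue-≡ (x ∷ xs) (best s) (All.map
      (λ τⱼ≤τₘ → ≤-trans τⱼ≤τₘ (≤-trans (≮⇒≥ w≮τ) (≤-reflexive (p≤q⇒p⊔q≡q w≤b))))
      (τ≤τ[topIndex] x xs)))

  data Plan : Set where
    take  : Fin n → Plan
    probe : Fin n → ℚ → Plan → Plan

  boxes : Plan → List (Fin n)
  boxes (take i)      = i ∷ []
  boxes (probe i _ p) = i ∷ boxes p

  thresholds : Plan → Fin n → ℚ
  thresholds (take _)      j = 0ℚ
  thresholds (probe i t p) j with j ≟ i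
  ... | yes _ = t
  ... | no _  = thresholds p j

  Agrees : Plan → (Fin n → ℚ) → Set
  Agrees (take _)      V = ⊤
  Agrees (probe i t p) V = V i ≡ t × Agrees p V

  agrees-cong : ∀ p {V V′} → (∀ {j} → j ∈ boxes p → V j ≡ V′ j) → Agrees p V → Agrees p V′
  agrees-cong (take _)      V≗V′ _             = tt
  agrees-cong (probe i t p) V≗V′ (Vᵢ≡t , agrees) =
    trans (sym (V≗V′ (here refl))) Vᵢ≡t , agrees-cong p (λ j∈ → V≗V′ (there j∈)) agrees

  agrees-thresholds : ∀ p → Unique (boxes p) → Agrees p (thresholds p)
  agrees-thresholds (take _)      _           = tt
  agrees-thresholds (probe i t p) (i∉ ∷ uniq) = own , agrees-cong p later (agrees-thresholds p uniq)
    where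
    own : thresholds (probe i t p) i ≡ t
    own with i ≟ i
    ... | yes _  = refl
    ... | no i≢i = ⊥-elim (i≢i refl)
    later : ∀ {j} → j ∈ boxes p → thresholds p j ≡ thresholds (probe i t p) j
    later {j} j∈ with j ≟ i
    ... | yes refl = ⊥-elim (All.lookup i∉ j∈ refl)
    ... | no _     = refl

  planPolicy   : Plan → List (Fin n) → State n → Policy n
  continuation : ℚ → Plan → List (Fin n) → State n → ℚ → Policy n

  planPolicy (take i)      L s = takeBox i
  planPolicy (probe i t p) L s = openBox i (λ v → continuation t p (remove i L) (update s i v) v)

  continuation t p L s v with t ≤? v
  ... | yes _ = indexPolicy (best s) (length L) L s
  ... | no _  = planPolicy p L s

  Fits : Plan → List (Fin n) → Set
  Fits (take i)      L = i ∈ L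
  Fits (probe i _ p) L = i ∈ L × Fits p (remove i L)

  boxes-⊆ : ∀ p {L} → Fits p L → All (_∈ L) (boxes p)
  boxes-⊆ (take _)      i∈L          = i∈L ∷ []
  boxes-⊆ (probe i _ p) (i∈L , fits) = i∈L ∷ All.map (λ j∈ → proj₁ (∈-remove⁻ j∈)) (boxes-⊆ p fits)

  boxes-unique : ∀ p {L} → Fits p L → Unique (boxes p)
  boxes-unique (take _)      _                = [] ∷ []
  boxes-unique (probe i _ p) {L} (i∈L , fits) =
    All.map (λ j∈ i≡j → proj₂ (∈-remove⁻ {L = L} j∈) (sym i≡j)) (boxes-⊆ p fits) ∷ boxes-unique p fits

  planPolicy-valid : ∀ p {s L} → Unopened s L → Fits p L → Valid s (planPolicy p L s)
  planPolicy-valid (take i)      U i∈L          = Unopened.∈⇒unopened U i∈L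
  planPolicy-valid (probe i t p) {s} {L} U (i∈L , fits) =
    Unopened.∈⇒unopened U i∈L , continuation-valid
    where
    continuation-valid : ∀ v → Valid (update s i v) (continuation t p (remove i L) (update s i v) v)
    continuation-valid v with t ≤? v
    ... | yes _ = indexPolicy-valid _ _ (indexPolicy-shape _ _ (unopened-update v U i∈L) ℕ.≤-refl)
    ... | no _  = planPolicy-valid p (unopened-update v U i∈L) fits

  continuation-shape : ∀ {σ V t} Vᵢ → Vᵢ ≡ t → ∀ p {s L} v → Unopened s L →
    ThresholdPhase τ σ V s (planPolicy p L s) →
    (Vᵢ ≤ v → IsIndexPolicy τ (best s) s (continuation t p L s v))
    × (v < Vᵢ → ThresholdPhase τ σ V s (continuation t p L s v))
  continuation-shape Vᵢ refl p v U phase with Vᵢ ≤? v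
  ... | yes Vᵢ≤v = (λ _ → indexPolicy-shape _ _ U ℕ.≤-refl)
                 , (λ v<Vᵢ → ⊥-elim (<-irrefl refl (<-≤-trans v<Vᵢ Vᵢ≤v)))
  ... | no Vᵢ≰v  = (λ Vᵢ≤v → ⊥-elim (Vᵢ≰v Vᵢ≤v)) , (λ _ → phase)

  -- The two `probe` clauses are identical: splitting p only makes `boxes p` reduce to a cons.
  planPolicy-shape : ∀ p {V s L} → Unopened s L → Fits p L → Agrees p V →
    ThresholdPhase τ (boxes p) V s (planPolicy p L s)
  planPolicy-shape (take i) U fits agrees = refl
  planPolicy-shape (probe i t p@(take _)) {V} U (i∈L , fits) (Vᵢ≡t , agrees) = _ , refl , λ v →
    let U′ = unopened-update v U i∈L in
    continuation-shape {boxes p} {V} (V i) Vᵢ≡t p v U′ (planPolicy-shape p {V} U′ fits agrees)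
  planPolicy-shape (probe i t p@(probe _ _ _)) {V} U (i∈L , fits) (Vᵢ≡t , agrees) = _ , refl , λ v →
    let U′ = unopened-update v U i∈L in
    continuation-shape {boxes p} {V} (V i) Vᵢ≡t p v U′ (planPolicy-shape p {V} U′ fits agrees)

  private
    values : Fin n → List ℚ
    values i = map proj₁ (support (F i))

    switch? : ∀ k L v → Dec (thresholdValue k L ≤ indexValue L v)
    switch? k L v = thresholdValue k L ≤? indexValue L v

    switch-mono : ∀ k L {u v} → u ≤ v →
      thresholdValue k L ≤ indexValue L u → thresholdValue k L ≤ indexValue L v
    switch-mono k L u≤v A≤W = ≤-trans A≤W (indexValue-mono L u≤v)

  -- The payoff only sees the support of F i, so the cutoff need only separate its points.
  cutoff : ℕ → List (Fin n) → Fin n → ℚ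
  cutoff k L i = threshold (switch? k (remove i L)) (switch-mono k (remove i L)) (values i)

  cutoff-separates : ∀ k L i → All (λ vp → let v = proj₁ vp in
      (cutoff k L i ≤ v → thresholdValue k (remove i L) ≤ indexValue (remove i L) v)
    × (v < cutoff k L i → ¬ thresholdValue k (remove i L) ≤ indexValue (remove i L) v)) (support (F i))
  cutoff-separates k L i = All.map⁻
    (threshold-separates (switch? k (remove i L)) (switch-mono k (remove i L)) (values i))

  plan      : ℕ → Fin n → List (Fin n) → Plan
  planAfter : ℕ → List (Fin n) → Fin n → List (Fin n) → Plan

  plan zero    x xs = take x
  plan (suc k) x xs = planAfter k (x ∷ xs) (firstBox k x xs) (remove (firstBox k x xs) (x ∷ xs))

  planAfter k L i []       = take i
  planAfter k L i (y ∷ ys) with probeValue k L i ≤? takeValue i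
  ... | yes _ = take i
  ... | no _  = probe i (cutoff k L i) (plan k y ys)

  plan-fits      : ∀ k x xs → Fits (plan k x xs) (x ∷ xs)
  planAfter-fits : ∀ k {L} i R → i ∈ L → remove i L ≡ R → Fits (planAfter k L i R) L

  plan-fits zero    x xs = here refl
  plan-fits (suc k) x xs = planAfter-fits k _ _ (firstBox-∈ k x xs) refl

  planAfter-fits k i []       i∈L _ = i∈L
  planAfter-fits k {L} i (y ∷ ys) i∈L rest with probeValue k L i ≤? takeValue i
  ... | yes _ = i∈L
  ... | no _  = i∈L , subst (Fits (plan k y ys)) (sym rest) (plan-fits k y ys)

  continuation-payoff : ∀ {A t} p {s L} v → Unopened s L → v ≤ best s →
    (t ≤ v → A ≤ indexValue L v) → (v < t → ¬ A ≤ indexValue L v) →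
    A ≤ payoff c F s (planPolicy p L s) →
    A ⊔ indexValue L v ≤ payoff c F s (continuation t p L s v)
  continuation-payoff {A} {t} p {s} {L} v U v≤b switch stay A≤plan with t ≤? v
  ... | yes t≤v = ⊔-lub (≤-trans (switch t≤v) W≤index) W≤index
    where W≤index = ≤-trans (indexValue-mono L v≤b)
                            (indexValue-≤-payoff (best s) (length L) U ℕ.≤-refl ≤-refl)
  ... | no t≰v  = ⊔-lub A≤plan (<⇒≤ (<-≤-trans (≰⇒> (stay (≰⇒> t≰v))) A≤plan))

  module _ (c≥0 : ∀ i → 0ℚ ≤ c i) where

    probeValue-last : ∀ k L i → remove i L ≡ [] → probeValue k L i ≤ takeValue i
    probeValue-last k L i last rewrite last = p≤q+r⇒p-r≤q (c i)
      (≤-trans (𝔼-mono-nonNeg (F i) (λ v 0≤v → ⊔-lub 0≤v ≤-refl)) (p≤p+q (c≥0 i)))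

    plan-payoff      : ∀ k x xs {s} → Unopened s (x ∷ xs) →
      thresholdValue k (x ∷ xs) ≤ payoff c F s (planPolicy (plan k x xs) (x ∷ xs) s)
    planAfter-payoff : ∀ k L i R {s} → Unopened s L → i ∈ L → remove i L ≡ R →
      startValue k L i ≤ payoff c F s (planPolicy (planAfter k L i R) L s)

    plan-payoff zero    x xs U = 𝔼-nonNeg (F x)
    plan-payoff (suc k) x xs U = planAfter-payoff k (x ∷ xs) _ _ U (firstBox-∈ k x xs) refl

    planAfter-payoff k L i []       U i∈L last = ⊔-lub ≤-refl (probeValue-last k L i last)
    planAfter-payoff k L i (y ∷ ys) {s} U i∈L rest with probeValue k L i ≤? takeValue i
    ... | yes probe≤take = ⊔-lub ≤-refl probe≤take
    ... | no probe≰take  = begin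
        startValue k L i
      ≤⟨ ⊔-lub (<⇒≤ (≰⇒> probe≰take)) ≤-refl ⟩
        𝔼 (F i) (λ v → thresholdValue k L′ ⊔ indexValue L′ v) - c i
      ≤⟨ +-monoˡ-≤ (- c i) (𝔼-mono-support (F i)
           (All.map (λ {vp} → pointwise {vp}) (cutoff-separates k L i))) ⟩
        𝔼 (F i) (λ v → payoff c F (s′ v) (continuation (cutoff k L i) p L′ (s′ v) v)) - c i ∎
      where
      open ≤-Reasoning
      L′ = remove i L
      p = plan k y ys
      s′ = update s i
      pointwise : ∀ {vp : ℚ × ℚ} → let v = proj₁ vp in
          (cutoff k L i ≤ v → thresholdValue k L′ ≤ indexValue L′ v)
        × (v < cutoff k L i → ¬ thresholdValue k L′ ≤ indexValue L′ v) →
        thresholdValue k L′ ⊔ indexValue L′ v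
          ≤ payoff c F (s′ v) (continuation (cutoff k L i) p L′ (s′ v) v)
      pointwise {v , _} (switch , stay) =
        continuation-payoff p v U′ (≤-best-update s i v (Unopened.∈⇒unopened U i∈L)) switch stay
          (subst (λ R → thresholdValue k R ≤ payoff c F (s′ v) (planPolicy p R (s′ v))) (sym rest)
                 (plan-payoff k y ys (subst (Unopened (s′ v)) rest U′)))
        where U′ = unopened-update v U i∈L

  hasShape : ∀ p {V A} → ThresholdPhase τ (boxes p) V initial A → HasShape τ (boxes p) V A
  hasShape (take _)      phase = phase
  hasShape (probe _ _ _) phase = phase

  optimal-if-attains : ∀ {L : List (Fin n)} {A} → Unopened initial L → Valid initial A →
    optimalValue (length L) L (best (initial {n})) ≤ payoff c F initial A → Optimal c F A
  optimal-if-attains {L} U valid attains =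
    valid , λ P validP → ≤-trans (payoff-≤-optimalValue (length L) U ℕ.≤-refl P validP) attains

  indexPolicy-optimal : ∀ {L : List (Fin n)} → Unopened initial L →
    thresholdValue (length L) L ≤ indexValue L (best (initial {n})) →
    Optimal c F (indexPolicy 0ℚ (length L) L initial)
  indexPolicy-optimal {L} U threshold≤index = optimal-if-attains U
    (indexPolicy-valid 0ℚ _ (indexPolicy-shape 0ℚ (length L) U ℕ.≤-refl))
    (⊔-lub (≤-trans threshold≤index index≤payoff) index≤payoff)
    where index≤payoff = indexValue-≤-payoff 0ℚ (length L) U ℕ.≤-refl (best-nonNeg (initial {n}))

  planPolicy-optimal : (∀ i → 0ℚ ≤ c i) → ∀ {x : Fin n} {xs} → Unopened initial (x ∷ xs) →
    ¬ thresholdValue (length (x ∷ xs)) (x ∷ xs) ≤ indexValue (x ∷ xs) (best (initial {n})) →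
    Optimal c F (planPolicy (plan (length (x ∷ xs)) x xs) (x ∷ xs) initial)
  planPolicy-optimal c≥0 {x} {xs} U threshold≰index =
    optimal-if-attains U (planPolicy-valid (plan (length (x ∷ xs)) x xs) U (plan-fits _ x xs))
      (⊔-lub threshold≤payoff (≤-trans (<⇒≤ (≰⇒> threshold≰index)) threshold≤payoff))
    where threshold≤payoff = plan-payoff c≥0 (length (x ∷ xs)) x xs U

theorem2 : (n : ℕ) (c : Fin n → ℚ) (F : Fin n → Dist) → (∀ i → 0ℚ ≤ c i)
    → (τ : Fin n → ℚ) → (∀ i → IsIndex (F i) (c i) (τ i))
    → Σ (Policy n) λ A → Optimal c F A
      × Σ (List (Fin n)) λ σ → Unique σ
      × Σ (Fin n → ℚ) λ V → HasShape τ σ V A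
theorem2 n c F c≥0 τ isIndex = optimalPolicy (allFin n) unopened-initial
  where
  open Pandora c F τ isIndex
  optimalPolicy : ∀ L → Unopened (initial {n}) L → Σ (Policy n) λ A → Optimal c F A
    × Σ (List (Fin n)) λ σ → Unique σ × Σ (Fin n → ℚ) λ V → HasShape τ σ V A
  optimalPolicy L U with thresholdValue (length L) L ≤? indexValue L (best (initial {n}))
  ... | yes threshold≤index = _ , indexPolicy-optimal U threshold≤index ,
    [] , [] , (λ _ → 0ℚ) , indexPolicy-shape 0ℚ (length L) U ℕ.≤-refl
  optimalPolicy []       U | no threshold≰index = ⊥-elim (threshold≰index (best-nonNeg (initial {n})))
  optimalPolicy (x ∷ xs) U | no threshold≰index = _ , planPolicy-optimal c≥0 U threshold≰index ,
    boxes p , boxes-unique p fits , thresholds p ,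
    hasShape p (planPolicy-shape p U fits (agrees-thresholds p (boxes-unique p fits)))
    where
    p = plan (length (x ∷ xs)) x xs
    fits = plan-fits _ x xs
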